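{- Let $C$ be a dendritic face complex with greatest element $\omega$, $n=\dim\omega$, and let $0\le k\le n-1$. If $d\prec^-\gamma^{(k+1)}\omega$, then $d\in\Lambda_k$.
   Context: A positive-to-one poset (POP) is a finite set $P$ with $\dim:P\to\mathbb{N}$ and binary relations $\prec^-,\prec^+$; $y\prec x$ means $y\prec^-x$ or $y\prec^+x$. Axioms: $y\prec x\Rightarrow\dim x=\dim y+1$; never both $y\prec^-x$ and $y\prec^+x$; every $x$ with $\dim x\ge1$ has exactly one $y$ with $y\prec^+x$, denoted $\gamma(x)$, and at least one $y$ with $y\prec^-x$. $\delta(x)=\{y:y\prec^-x\}$, $C_k=\dim^{ -1}(k)$; $\le$ is the reflexive-transitive closure of $\prec$. A dendritic face complex is a POP such that: it has a greatest element for $\le$; (oriented thinness) whenever $z\prec^{\beta}y\prec^{\alpha}x$ there is a unique $y'\ne y$ with $z\prec y'\prec x$, and writing $z\prec^{\beta'}y'\prec^{\alpha'}x$ the signs (as $\pm1$) satisfy $\alpha\beta=-\alpha'\beta'$; (acyclicity) $\delta(x)$ is a singleton if $\dim x=1$, nonempty if $\dim x\ge1$, and for $\dim x\ge1$ there are no $p\ge1$, $y_1,\dots,y_p\in\delta(x)$ with $\gamma(y_{i+1})\in\delta(y_i)$ ($1\le i<p$) and $\gamma(y_1)\in\delta(y_p)$. For $0\le k\le n$, $\gamma^{(k)}\omega:=\gamma^{n-k}(\omega)$; $\Lambda_k:=C_k\setminus\{\gamma(c):c\in C_{k+1}\}$. -}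

module Defs where

open import Data.Nat using (ℕ; zero; suc; _+_; _∸_; _≤_)
open import Data.Fin using (Fin)
open import Data.Bool using (Bool; T)
open import Data.Sign using (Sign; opposite) renaming (_*_ to _*ₛ_)
open import Data.Product using (Σ; ∃; ∃-syntax; _×_; _,_)
open import Data.Sum using (_⊎_)
open import Relation.Nullary using (¬_)
open import Relation.Binary.PropositionalEquality using (_≡_; _≢_)
open import Relation.Binary.Construct.Closure.ReflexiveTransitive using (Star)

-- A finite set P is represented as Fin N.
module Raw {N : ℕ} (dim : Fin N → ℕ) (neg pos : Fin N → Fin N → Bool) where

  _≺⁻_ : Fin N → Fin N → Set
  y ≺⁻ x = T (neg y x)

  _≺⁺_ : Fin N → Fin N → Set
  y ≺⁺ x = T (pos y x)

  _≺[_]_ : Fin N → Sign → Fin N → Set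
  y ≺[ Sign.- ] x = y ≺⁻ x
  y ≺[ Sign.+ ] x = y ≺⁺ x

  _≺_ : Fin N → Fin N → Set
  y ≺ x = (y ≺⁻ x) ⊎ (y ≺⁺ x)

  _≼_ : Fin N → Fin N → Set
  _≼_ = Star _≺_

  InC : ℕ → Fin N → Set
  InC k x = dim x ≡ k

  -- Λ_k = C_k ∖ { γ(c) : c ∈ C_{k+1} };  since γ(c) is the unique y with
  -- y ≺⁺ c, "d = γ(c)" is expressed as "d ≺⁺ c".
  InΛ : ℕ → Fin N → Set
  InΛ k d = InC k d × ¬ (∃[ c ] (InC (suc k) c × d ≺⁺ c))

  -- IterΓ j x z : z = γ^j(x)   (γ(x) being the unique y with y ≺⁺ x)
  data IterΓ : ℕ → Fin N → Fin N → Set where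
    here  : ∀ {x} → IterΓ zero x x
    there : ∀ {j x y z} → y ≺⁺ x → IterΓ j y z → IterΓ (suc j) x z

  -- γ(b) ∈ δ(a)
  Linked : Fin N → Fin N → Set
  Linked a b = ∃[ g ] (g ≺⁺ b × g ≺⁻ a)

  -- a cycle y₁,…,y_p (p = suc q ≥ 1) in δ(x) with γ(y_{i+1}) ∈ δ(y_i)
  -- and γ(y₁) ∈ δ(y_p), written as a p-periodic sequence ℕ → P
  -- (indices taken mod p).
  Cycle : Fin N → Set
  Cycle x = ∃[ q ] Σ (ℕ → Fin N) λ y →
              (∀ i → y (i + suc q) ≡ y i)
            × (∀ i → y i ≺⁻ x)
            × (∀ i → Linked (y i) (y (suc i)))

record POP : Set₁ where
  field
    N   : ℕ
    dim : Fin N → ℕ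
    neg : Fin N → Fin N → Bool
    pos : Fin N → Fin N → Bool
  open Raw dim neg pos public
  field
    dim-≺    : ∀ {x y} → y ≺ x → dim x ≡ suc (dim y)
    disjoint : ∀ {x y} → y ≺⁻ x → ¬ (y ≺⁺ x)
    γ-unique : ∀ x → 1 ≤ dim x →
               ∃[ y ] (y ≺⁺ x × (∀ y' → y' ≺⁺ x → y' ≡ y))
    δ-nonempty : ∀ x → 1 ≤ dim x → ∃[ y ] (y ≺⁻ x)

record DendriticFaceComplex : Set₁ where
  field
    pop : POP
  open POP pop public
  field
    ω        : Fin N
    greatest : ∀ x → x ≼ ω
    oriented-thin :
      ∀ {x y z} (α β : Sign) → z ≺[ β ] y → y ≺[ α ] x →
      ∃[ y' ] (y' ≢ y
              × (∃[ β' ] ∃[ α' ] (z ≺[ β' ] y' × y' ≺[ α' ] x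
                                  × (α *ₛ β) ≡ opposite (α' *ₛ β')))
              × (∀ y'' → y'' ≢ y → z ≺ y'' → y'' ≺ x → y'' ≡ y'))
    δ-singleton : ∀ x → dim x ≡ 1 →
                  ∃[ y ] (y ≺⁻ x × (∀ y' → y' ≺⁻ x → y' ≡ y))
    δ-nonempty' : ∀ x → 1 ≤ dim x → ∃[ y ] (y ≺⁻ x)
    acyclic : ∀ x → 1 ≤ dim x → ¬ Cycle x

  n : ℕ
  n = dim ω

{-# OPTIONS --safe #-}
module Submission where

-- Induction on j shows that if d ≺⁻ γʲ(x), then no w ≤ x has γ(w) = d. A descending chain
-- from x to such a w has length j (count dimensions). If it starts with γ(x), use the induction
-- hypothesis. If it starts with an input and j = 1, oriented thinness at d ≺⁻ γ(x) ≺⁺ x gives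
-- only one other face of x containing d; it contains d negatively and must also be w. If j ≥ 2,
-- thinness lets a chain from an input z of x be rerouted through an input u of z. Thinness at
-- u ≺⁻ z ≺⁻ x then gives another face v of x through u. By the induction hypothesis v ≠ γ(x),
-- so v ∈ δ(x) and γ(v) = u ∈ δ(z). Repeating this walks forever inside the finite set δ(x), so
-- it closes up into a cycle, which acyclicity forbids.

open import Defs
open import Data.Nat using (ℕ; zero; suc; _+_; _*_; _∸_; _<_; _≤_; z≤n; s≤s; NonZero)
open import Data.Nat.Properties
open import Data.Nat.DivMod using (_%_; _/_; m≡m%n+[m/n]*n; [m+kn]%n≡m%n; [m+n]%n≡m%n; m<n⇒m%n≡m; n%n≡0; m%n<n)
open import Data.Fin using (Fin; toℕ)
open import Data.Fin.Properties using (pigeonhole)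
open import Data.Sign using (Sign; opposite)
open import Data.Sign.Properties using (opposite-involutive; opposite-injective)
open import Data.Product using (Σ; ∃-syntax; _×_; _,_; proj₁; proj₂; map; map₂)
open import Data.Sum using (_⊎_; inj₁; inj₂)
open import Data.Empty using (⊥; ⊥-elim)
open import Function using (id; flip)
open import Relation.Nullary using (¬_)
open import Relation.Binary.PropositionalEquality
open import Relation.Binary.Construct.Closure.ReflexiveTransitive using (Star; ε; _◅_; reverse)

[1+m]%n≡[1+m%n]%n : ∀ m n .{{_ : NonZero n}} → suc m % n ≡ suc (m % n) % n
[1+m]%n≡[1+m%n]%n m n = begin
  suc m % n                    ≡⟨ cong (λ k → suc k % n) (m≡m%n+[m/n]*n m n) ⟩
  suc (m % n + m / n * n) % n  ≡⟨ [m+kn]%n≡m%n (suc (m % n)) (m / n) n ⟩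
  suc (m % n) % n              ∎
  where open ≡-Reasoning

PeriodicChain : ∀ {N} → (Fin N → Set) → (Fin N → Fin N → Set) → Set
PeriodicChain {N} P R = ∃[ q ] Σ (ℕ → Fin N) λ y →
  (∀ i → y (i + suc q) ≡ y i) × (∀ i → P (y i)) × (∀ i → R (y i) (y (suc i)))

module _ {N : ℕ} {P : Fin N → Set} {R : Fin N → Fin N → Set}
         (s : ℕ → Fin N) (s∈P : ∀ i → P (s i)) (s-R : ∀ i → R (s i) (s (suc i))) where

  recurrence⇒PeriodicChain : ∀ a q → s a ≡ s (a + suc q) → PeriodicChain P R
  recurrence⇒PeriodicChain a q sₐ≡sₐ₊ₚ = q , y , y-periodic , (λ t → s∈P (a + t % p)) , y-R
    where
    open ≡-Reasoning
    p : ℕ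
    p = suc q

    y : ℕ → Fin N
    y t = s (a + t % p)

    y-periodic : ∀ t → y (t + p) ≡ y t
    y-periodic t = cong (λ r → s (a + r)) ([m+n]%n≡m%n t p)

    s-wraps : ∀ r → r ≤ p → s (a + r) ≡ s (a + r % p)
    s-wraps r r≤p with m≤n⇒m<n∨m≡n r≤p
    ... | inj₁ r<p  = cong (λ r′ → s (a + r′)) (sym (m<n⇒m%n≡m r<p))
    ... | inj₂ refl = begin
      s (a + p)      ≡⟨ sₐ≡sₐ₊ₚ ⟨
      s a            ≡⟨ cong s (+-identityʳ a) ⟨
      s (a + 0)      ≡⟨ cong (λ r′ → s (a + r′)) (n%n≡0 p) ⟨
      s (a + p % p)  ∎

    y-R : ∀ t → R (y t) (y (suc t))
    y-R t = subst (R (y t)) s[1+]≡y[1+] (s-R (a + t % p))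
      where
      s[1+]≡y[1+] : s (suc (a + t % p)) ≡ y (suc t)
      s[1+]≡y[1+] = begin
        s (suc (a + t % p))      ≡⟨ cong s (+-suc a (t % p)) ⟨
        s (a + suc (t % p))      ≡⟨ s-wraps (suc (t % p)) (m%n<n t p) ⟩
        s (a + suc (t % p) % p)  ≡⟨ cong (λ r → s (a + r)) ([1+m]%n≡[1+m%n]%n t p) ⟨
        y (suc t)                ∎

serial⇒PeriodicChain : ∀ {N} {P : Fin N → Set} {R : Fin N → Fin N → Set} →
                       (∀ {z} → P z → ∃[ z′ ] (P z′ × R z z′)) → ∀ {z} → P z → PeriodicChain P R
serial⇒PeriodicChain {N} {P} {R} next {z₀} p₀ =
  let (i , j , i<j , sᵢ≡sⱼ) = pigeonhole (n<1+n N) (λ k → s (toℕ k)) in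
  recurrence⇒PeriodicChain {P = P} {R} s (λ t → proj₂ (orbit t)) s-R (toℕ i) (toℕ j ∸ suc (toℕ i))
    (trans sᵢ≡sⱼ (cong s (sym (trans (+-suc (toℕ i) _) (m+[n∸m]≡n i<j)))))
  where
  orbit : ℕ → Σ (Fin N) P
  orbit zero    = z₀ , p₀
  orbit (suc t) = map₂ proj₁ (next (proj₂ (orbit t)))

  s : ℕ → Fin N
  s t = proj₁ (orbit t)

  s-R : ∀ t → R (s t) (s (suc t))
  s-R t = proj₂ (proj₂ (next (proj₂ (orbit t))))

module POPProperties (P : POP) where
  open POP P

  ≺⇒1≤dim : ∀ {x y} → y ≺ x → 1 ≤ dim x
  ≺⇒1≤dim y≺x = subst (1 ≤_) (sym (dim-≺ y≺x)) (s≤s z≤n)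

  ≺⁺-unique : ∀ {x y y′} → y ≺⁺ x → y′ ≺⁺ x → y ≡ y′
  ≺⁺-unique {x} y≺⁺x y′≺⁺x =
    let (_ , _ , is-γ) = γ-unique x (≺⇒1≤dim (inj₂ y≺⁺x)) in
    trans (is-γ _ y≺⁺x) (sym (is-γ _ y′≺⁺x))

  infixr 5 _∷_
  data Descent : ℕ → Fin N → Fin N → Set where
    []  : ∀ {x} → Descent zero x x
    _∷_ : ∀ {m x y w} → y ≺ x → Descent m y w → Descent (suc m) x w

  ≼⇒Descent : ∀ {x w} → w ≼ x → ∃[ m ] Descent m x w
  ≼⇒Descent w≼x = fromStar (reverse {U = flip _≺_} id w≼x)
    where
    fromStar : ∀ {x w} → Star (flip _≺_) x w → ∃[ m ] Descent m x w
    fromStar ε          = zero , []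
    fromStar (y≺x ◅ rs) = map suc (y≺x ∷_) (fromStar rs)

  IterΓ⇒Descent : ∀ {j x g} → IterΓ j x g → Descent j x g
  IterΓ⇒Descent here             = []
  IterΓ⇒Descent (there y≺⁺x it) = inj₂ y≺⁺x ∷ IterΓ⇒Descent it

  descent-dim : ∀ {m x w} → Descent m x w → dim x ≡ m + dim w
  descent-dim []          = refl
  descent-dim (y≺x ∷ ds) = trans (dim-≺ y≺x) (cong suc (descent-dim ds))

  descent-length : ∀ {m m′ x w w′} → Descent m x w → Descent m′ x w′ → dim w ≡ dim w′ → m ≡ m′
  descent-length {m} {m′} {x} {w} {w′} ds ds′ dim-w≡dim-w′ = +-cancelʳ-≡ (dim w′) m m′ (begin
    m + dim w′   ≡⟨ cong (m +_) dim-w≡dim-w′ ⟨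
    m + dim w    ≡⟨ descent-dim ds ⟨
    dim x        ≡⟨ descent-dim ds′ ⟩
    m′ + dim w′  ∎)
    where open ≡-Reasoning

module DendriticProperties (C : DendriticFaceComplex) where
  open DendriticFaceComplex C
  open POPProperties pop

  other-face-of-γ : ∀ {x y z} β → z ≺[ β ] y → y ≺⁺ x →
                    ∃[ v ] (v ≺⁻ x × z ≺[ β ] v × (∀ u → u ≢ y → z ≺ u → u ≺ x → u ≡ v))
  other-face-of-γ β z≺y y≺⁺x with oriented-thin Sign.+ β z≺y y≺⁺x
  ... | v , v≢y , (_  , Sign.+ , _    , v≺⁺x , _) , _ = ⊥-elim (v≢y (≺⁺-unique v≺⁺x y≺⁺x))
  ... | v , _   , (β′ , Sign.- , z≺v , v≺⁻x , signs) , unique =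
    v , v≺⁻x , subst (_ ≺[_] v) (sym (trans signs (opposite-involutive β′))) z≺v , unique

  other-face-of-input : ∀ {x y z} β → z ≺[ β ] y → y ≺⁻ x →
                        ∃[ v ] ((v ≺⁺ x × z ≺[ β ] v) ⊎ (v ≺⁻ x × z ≺[ opposite β ] v))
  other-face-of-input β z≺y y≺⁻x with oriented-thin Sign.- β z≺y y≺⁻x
  ... | v , _ , (β′ , Sign.+ , z≺v , v≺⁺x , signs) , _ =
    v , inj₁ (v≺⁺x , subst (_ ≺[_] v) (sym (opposite-injective signs)) z≺v)
  ... | v , _ , (β′ , Sign.- , z≺v , v≺⁻x , signs) , _ =
    v , inj₂ (v≺⁻x , subst (_ ≺[_] v) (sym (trans signs (opposite-involutive β′))) z≺v)

  δγ-disjoint-γδ : ∀ {x g y d} → d ≺⁻ g → g ≺⁺ x → d ≺⁺ y → y ≺⁻ x → ⊥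
  δγ-disjoint-γδ {g = g} {y} {d} d≺⁻g g≺⁺x d≺⁺y y≺⁻x =
    let (v , _ , d≺⁻v , unique) = other-face-of-γ Sign.- d≺⁻g g≺⁺x in
    disjoint (subst (d ≺⁻_) (sym (unique _ y≢g (inj₂ d≺⁺y) (inj₁ y≺⁻x))) d≺⁻v) d≺⁺y
    where
    y≢g : y ≢ g
    y≢g refl = disjoint y≺⁻x g≺⁺x

  Above⁺ : ℕ → Fin N → Fin N → Set
  Above⁺ m x d = ∃[ w ] (d ≺⁺ w × Descent m x w)

  Above⁺-via-input : ∀ {m x d} → Above⁺ (suc m) x d → ∃[ u ] (u ≺⁻ x × Above⁺ m u d)
  Above⁺-via-input (w , d≺⁺w , inj₁ u≺⁻x ∷ ds) = _ , u≺⁻x , w , d≺⁺w , ds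
  Above⁺-via-input (w , d≺⁺w , inj₂ w≺⁺x ∷ []) =
    let (v , v≺⁻x , d≺⁺v , _) = other-face-of-γ Sign.+ d≺⁺w w≺⁺x in
    v , v≺⁻x , v , d≺⁺v , []
  Above⁺-via-input (w , d≺⁺w , inj₂ y≺⁺x ∷ ds@(_ ∷ _)) =
    let (u , u≺⁻y , w′ , d≺⁺w′ , ds′) = Above⁺-via-input (w , d≺⁺w , ds)
        (v , v≺⁻x , u≺⁻v , _)         = other-face-of-γ Sign.- u≺⁻y y≺⁺x
    in v , v≺⁻x , w′ , d≺⁺w′ , inj₁ u≺⁻v ∷ ds′

  Linked-successor : ∀ {m x g z d} → g ≺⁺ x → ¬ Above⁺ (suc m) g d →
                     z ≺⁻ x → Above⁺ (suc m) z d →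
                     ∃[ z′ ] ((z′ ≺⁻ x × Above⁺ (suc m) z′ d) × Linked z z′)
  Linked-successor g≺⁺x γ-not-above z≺⁻x z-above
    with u , u≺⁻z , w , d≺⁺w , ds ← Above⁺-via-input z-above
    with other-face-of-input Sign.- u≺⁻z z≺⁻x
  ... | v , inj₁ (v≺⁺x , u≺⁻v) with refl ← ≺⁺-unique v≺⁺x g≺⁺x =
    ⊥-elim (γ-not-above (w , d≺⁺w , inj₁ u≺⁻v ∷ ds))
  ... | v , inj₂ (v≺⁻x , u≺⁺v) = v , (v≺⁻x , w , d≺⁺w , inj₂ u≺⁺v ∷ ds) , (u , u≺⁺v , u≺⁻z)

  ¬Above⁺-γ-iterate : ∀ {j x g d} → IterΓ j x g → d ≺⁻ g → ¬ Above⁺ j x d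
  ¬Above⁺-γ-iterate here d≺⁻g (w , d≺⁺w , []) = disjoint d≺⁻g d≺⁺w
  ¬Above⁺-γ-iterate (there g≺⁺x it) d≺⁻g (w , d≺⁺w , inj₂ y≺⁺x ∷ ds)
    with refl ← ≺⁺-unique y≺⁺x g≺⁺x = ¬Above⁺-γ-iterate it d≺⁻g (w , d≺⁺w , ds)
  ¬Above⁺-γ-iterate (there g≺⁺x here) d≺⁻g (w , d≺⁺w , inj₁ w≺⁻x ∷ []) =
    δγ-disjoint-γδ d≺⁻g g≺⁺x d≺⁺w w≺⁻x
  ¬Above⁺-γ-iterate {suc (suc m)} {x} {d = d}
                    (there g≺⁺x it) d≺⁻g (w , d≺⁺w , inj₁ y≺⁻x ∷ ds@(_ ∷ _)) =
    let (q , y , periodic , inputs-above , linked) =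
          serial⇒PeriodicChain {P = λ z → z ≺⁻ x × Above⁺ (suc m) z d} {R = Linked}
            (λ (z≺⁻x , z-above) → Linked-successor g≺⁺x (¬Above⁺-γ-iterate it d≺⁻g) z≺⁻x z-above)
            (y≺⁻x , w , d≺⁺w , ds)
    in acyclic x (≺⇒1≤dim (inj₁ y≺⁻x)) (q , y , periodic , (λ i → proj₁ (inputs-above i)) , linked)

  input-of-γ-iterate-is-not-γ : ∀ {j x g d c} → IterΓ j x g → d ≺⁻ g → d ≺⁺ c → c ≼ x → ⊥
  input-of-γ-iterate-is-not-γ {j} {x} {g} {d} {c} it d≺⁻g d≺⁺c c≼x =
    let (_ , x⇝c) = ≼⇒Descent c≼x in
    ¬Above⁺-γ-iterate it d≺⁻g (c , d≺⁺c , subst (λ k → Descent k x c) (length≡j x⇝c) x⇝c)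
    where
    length≡j : ∀ {m} → Descent m x c → m ≡ j
    length≡j x⇝c = descent-length x⇝c (IterΓ⇒Descent it)
                     (trans (dim-≺ (inj₂ d≺⁺c)) (sym (dim-≺ (inj₁ d≺⁻g))))

mainTheorem19 : (C : DendriticFaceComplex) → let open DendriticFaceComplex C in
    ∀ (k : ℕ) → k < n → ∀ g d → IterΓ (n ∸ suc k) ω g → d ≺⁻ g → InΛ k d
mainTheorem19 C k k<n g d ω⇝g d≺⁻g =
  dim-d≡k , λ (c , _ , d≺⁺c) → input-of-γ-iterate-is-not-γ ω⇝g d≺⁻g d≺⁺c (greatest c)
  where
  open DendriticFaceComplex C
  open POPProperties pop
  open DendriticProperties C
  open ≡-Reasoning

  dim-d≡k : dim d ≡ k
  dim-d≡k = suc-injective (+-cancelˡ-≡ (n ∸ suc k) _ _ (begin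
    n ∸ suc k + suc (dim d)  ≡⟨ cong (n ∸ suc k +_) (dim-≺ (inj₁ d≺⁻g)) ⟨
    n ∸ suc k + dim g        ≡⟨ descent-dim (IterΓ⇒Descent ω⇝g) ⟨
    n                        ≡⟨ m∸n+n≡m k<n ⟨
    n ∸ suc k + suc k        ∎))
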